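{- Let $a,b\ge 1$ and $k$ be integers with $2\le k\le a$. Then $\gamma(K^+_{a,b})=a$ and $\gamma_{k{\rm rt}}(K^+_{a,b})=2a$.
   Context: All graphs are finite, simple and undirected; $N(v)$ denotes the open neighborhood of $v$, and $[k]=\{1,\dots,k\}$. $\gamma(G)$ is the domination number. A $k$-rainbow dominating function ($k$RDF) of $G$ is a function $f:V(G)\to 2^{[k]}$ such that every vertex $v$ with $f(v)=\emptyset$ satisfies $\bigcup_{u\in N(v)}f(u)=[k]$. A $k$-rainbow total dominating function ($k$RTDF) is a $k$RDF $f$ such that additionally, for every vertex $v$ with $f(v)=\{i\}$ for some $i\in[k]$, there is $u\in N(v)$ with $i\in f(u)$. The weight of $f$ is $\|f\|=\sum_{v\in V(G)}|f(v)|$, and $\gamma_{k{\rm rt}}(G)$ is the minimum weight of a $k$RTDF of $G$. $K_{a,b}$ is the complete bipartite graph with parts $A=\{x_1,\dots,x_a\}$ and $B$ with $|B|=b$. $K^+_{a,b}$ is obtained from $K_{a,b}$ by adding new vertices $y_1,\dots,y_a$ and new edges $x_iy_i$ for every $i\in[a]$. -}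

module Defs where

open import Data.Nat using (ℕ; _≤_; _+_)
open import Data.Fin using (Fin; splitAt)
open import Data.Fin.Subset as S using (Subset; _∈_; ⁅_⁆; ∣_∣)
open import Data.Vec using (sum; tabulate)
open import Data.Product using (Σ; _×_; ∃; _,_)
open import Data.Sum using (_⊎_; inj₁; inj₂)
open import Data.Unit using (⊤)
open import Data.Empty using (⊥)
open import Relation.Nullary using (¬_)
open import Relation.Binary.PropositionalEquality using (_≡_; refl; sym)

record Graph : Set₁ where
  field
    n     : ℕ
    Adj   : Fin n → Fin n → Set
    symm  : ∀ {u v} → Adj u v → Adj v u
    irrefl : ∀ {v} → ¬ Adj v v
open Graph public

module _ (G : Graph) where
  IsDominating : Subset (n G) → Set
  IsDominating D = ∀ v → v ∈ D ⊎ ∃ λ u → Adj G v u × u ∈ D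

  DominationNumberIs : ℕ → Set
  DominationNumberIs m =
    (Σ (Subset (n G)) λ D → IsDominating D × ∣ D ∣ ≡ m) ×
    (∀ D → IsDominating D → m ≤ ∣ D ∣)

module _ (k : ℕ) (G : Graph) where
  IsKRDF : (Fin (n G) → Subset k) → Set
  IsKRDF f = ∀ v → f v ≡ S.⊥ → ∀ (c : Fin k) → ∃ λ u → Adj G v u × c ∈ f u

  IsKRTDF : (Fin (n G) → Subset k) → Set
  IsKRTDF f = IsKRDF f ×
    (∀ v (i : Fin k) → f v ≡ ⁅ i ⁆ → ∃ λ u → Adj G v u × i ∈ f u)

  weight : (Fin (n G) → Subset k) → ℕ
  weight f = sum (tabulate (λ v → ∣ f v ∣))

  KRTDNumberIs : ℕ → Set
  KRTDNumberIs m =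
    (Σ (Fin (n G) → Subset k) λ f → IsKRTDF f × weight f ≡ m) ×
    (∀ f → IsKRTDF f → m ≤ weight f)

-- The graph K⁺_{a,b}: vertices x_1..x_a (part A), y_1..y_a (pendants), and part B.
data Kind (a b : ℕ) : Set where
  X : Fin a → Kind a b
  Y : Fin a → Kind a b
  Z : Fin b → Kind a b

KAdj : ∀ {a b} → Kind a b → Kind a b → Set
KAdj (X i) (Z j) = ⊤
KAdj (Z j) (X i) = ⊤
KAdj (X i) (Y i') = i ≡ i'
KAdj (Y i) (X i') = i ≡ i'
KAdj _ _ = ⊥

KAdj-sym : ∀ {a b} {u v : Kind a b} → KAdj u v → KAdj v u
KAdj-sym {u = X i} {Z j} p = p
KAdj-sym {u = Z j} {X i} p = p
KAdj-sym {u = X i} {Y i'} p = sym p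
KAdj-sym {u = Y i} {X i'} p = sym p

KAdj-irrefl : ∀ {a b} {v : Kind a b} → ¬ KAdj v v
KAdj-irrefl {v = X i} ()
KAdj-irrefl {v = Y i} ()
KAdj-irrefl {v = Z j} ()

kind : ∀ a b → Fin (a + a + b) → Kind a b
kind a b v with splitAt (a + a) v
... | inj₂ j = Z j
... | inj₁ w with splitAt a w
...   | inj₁ i = X i
...   | inj₂ i = Y i

K⁺ : ℕ → ℕ → Graph
K⁺ a b = record
  { n = a + a + b
  ; Adj = λ u v → KAdj (kind a b u) (kind a b v)
  ; symm = KAdj-sym
  ; irrefl = λ {v} → KAdj-irrefl {v = kind a b v}
  }

module Submission where

-- The whole argument rests on the pendant vertices: y_i has x_i as its only
-- neighbour.  Hence a dominating set meets every pair {x_i, y_i}, and a kRTDF f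
-- has |f(x_i)| + |f(y_i)| ≥ 2 on every pair: if f(y_i) = ∅ then x_i alone must
-- carry all k ≥ 2 colours, if f(y_i) = {c} then c ∈ f(x_i), and otherwise
-- already |f(y_i)| ≥ 2.  Summing over the a disjoint pairs gives the lower
-- bounds a and 2a.  They are attained by the part A = {x_1,…,x_a}, and by the
-- labelling f(x_i) = f(y_i) = {i mod k}, f(B) = ∅, which is a kRTDF because
-- k ≤ a makes every colour occur on some x_i, and every x_i is adjacent to B.

open import Defs
open import Data.Nat using (ℕ; _≤_; _*_)
open import Data.Product using (_×_)

open import Data.Nat using (suc; _+_; _%_; z≤n; s≤s; NonZero; >-nonZero)
open import Data.Nat.Properties
  using (≤-trans; +-mono-≤; m≤m+n; m≤n+m; *-identityʳ; *-zeroʳ; *-comm; +-identityʳ; +-assoc; +-commutativeSemigroup)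
open import Data.Nat.DivMod using (m%n<n; m<n⇒m%n≡m)
open import Algebra.Properties.CommutativeSemigroup +-commutativeSemigroup using (interchange)
open import Data.Fin using (Fin; zero; suc; splitAt; join; _↑ˡ_; _↑ʳ_; toℕ; fromℕ<; inject≤)
open import Data.Fin.Properties
  using (splitAt-↑ˡ; splitAt-↑ʳ; join-splitAt; toℕ-fromℕ<; toℕ-inject≤; toℕ-injective; toℕ<n)
open import Data.Fin.Subset as S using (Subset; Side; inside; outside; _∈_; _⊆_; ⁅_⁆; ∣_∣)
open import Data.Fin.Subset.Properties using (∉⊥; x∈⁅x⁆; x∈⁅y⁆⇒x≡y; ∣⁅x⁆∣≡1; ∣⊥∣≡0; ∣⊤∣≡n; p⊆q⇒∣p∣≤∣q∣)
open import Data.Vec using ([]; _∷_; sum; tabulate; lookup)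
open import Data.Vec.Properties using (tabulate-cong; lookup∘tabulate; []=⇒lookup; lookup⇒[]=)
open import Data.Product using (∃; _,_)
open import Data.Sum using (inj₁; inj₂)
open import Data.Unit using (tt)
open import Data.Empty using (⊥-elim)
open import Relation.Nullary using (¬_)
open import Relation.Binary.PropositionalEquality
open ≡-Reasoning

∑ : ∀ {n} → (Fin n → ℕ) → ℕ
∑ g = sum (tabulate g)

∑-cong : ∀ {n} {g h : Fin n → ℕ} → (∀ i → g i ≡ h i) → ∑ g ≡ ∑ h
∑-cong g≗h = cong sum (tabulate-cong g≗h)

∑-split : ∀ m {n} (g : Fin (m + n) → ℕ) →
          ∑ g ≡ ∑ (λ i → g (i ↑ˡ n)) + ∑ (λ j → g (m ↑ʳ j))
∑-split ℕ.zero    g = refl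
∑-split (ℕ.suc m) g =
  trans (cong (g zero +_) (∑-split m (λ i → g (suc i)))) (sym (+-assoc (g zero) _ _))

∑-+ : ∀ {n} (g h : Fin n → ℕ) → ∑ (λ i → g i + h i) ≡ ∑ g + ∑ h
∑-+ {ℕ.zero}  g h = refl
∑-+ {ℕ.suc n} g h = begin
  g zero + h zero + ∑ (λ i → g (suc i) + h (suc i))
    ≡⟨ cong (g zero + h zero +_) (∑-+ (λ i → g (suc i)) (λ i → h (suc i))) ⟩
  g zero + h zero + (∑ (λ i → g (suc i)) + ∑ (λ i → h (suc i)))
    ≡⟨ interchange (g zero) (h zero) _ _ ⟩
  g zero + ∑ (λ i → g (suc i)) + (h zero + ∑ (λ i → h (suc i)))  ∎

∑-const : ∀ n c → ∑ {n} (λ _ → c) ≡ n * c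
∑-const ℕ.zero    c = refl
∑-const (ℕ.suc n) c = cong (c +_) (∑-const n c)

∑-lower : ∀ {n} c (g : Fin n → ℕ) → (∀ i → c ≤ g i) → n * c ≤ ∑ g
∑-lower {ℕ.zero}  c g c≤g = z≤n
∑-lower {ℕ.suc n} c g c≤g =
  +-mono-≤ (c≤g zero) (∑-lower c (λ i → g (suc i)) (λ i → c≤g (suc i)))

count : Side → ℕ
count inside  = 1
count outside = 0

indicator : ∀ {n} → Subset n → Fin n → ℕ
indicator p i = count (lookup p i)

∣∣≡∑indicator : ∀ {n} (p : Subset n) → ∣ p ∣ ≡ ∑ (indicator p)
∣∣≡∑indicator []            = refl
∣∣≡∑indicator (inside  ∷ p) = cong suc (∣∣≡∑indicator p)
∣∣≡∑indicator (outside ∷ p) = ∣∣≡∑indicator p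

indicator-∈ : ∀ {n} {p : Subset n} {x} → x ∈ p → indicator p x ≡ 1
indicator-∈ x∈p = cong count ([]=⇒lookup x∈p)

∈⇒1≤∣∣ : ∀ {n} {p : Subset n} {x} → x ∈ p → 1 ≤ ∣ p ∣
∈⇒1≤∣∣ {p = p} {x} x∈p = subst (_≤ ∣ p ∣) (∣⁅x⁆∣≡1 x) (p⊆q⇒∣p∣≤∣q∣ ⁅x⁆⊆p)
  where
  ⁅x⁆⊆p : ⁅ x ⁆ ⊆ p
  ⁅x⁆⊆p y∈⁅x⁆ = subst (_∈ p) (sym (x∈⁅y⁆⇒x≡y x y∈⁅x⁆)) x∈p

single≢⊥ : ∀ {n} (c : Fin n) → ¬ ⁅ c ⁆ ≡ S.⊥
single≢⊥ c ⁅c⁆≡⊥ = ∉⊥ (subst (c ∈_) ⁅c⁆≡⊥ (x∈⁅x⁆ c))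

data Shape {n} (p : Subset n) : Set where
  empty  : p ≡ S.⊥ → Shape p
  single : ∀ c → p ≡ ⁅ c ⁆ → Shape p
  many   : 2 ≤ ∣ p ∣ → Shape p

shape : ∀ {n} (p : Subset n) → Shape p
shape [] = empty refl
shape (outside ∷ p) with shape p
... | empty  p≡⊥    = empty (cong (outside ∷_) p≡⊥)
... | single c p≡⁅c⁆ = single (suc c) (cong (outside ∷_) p≡⁅c⁆)
... | many   2≤∣p∣  = many 2≤∣p∣
shape (inside ∷ p) with shape p
... | empty  p≡⊥    = single zero (cong (inside ∷_) p≡⊥)
... | single c p≡⁅c⁆ = many (s≤s (∈⇒1≤∣∣ (subst (c ∈_) (sym p≡⁅c⁆) (x∈⁅x⁆ c))))
... | many   2≤∣p∣  = many (≤-trans 2≤∣p∣ (m≤n+m _ 1))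

module Pendant (G : Graph) where

  OnlyNeighbour : Fin (n G) → Fin (n G) → Set
  OnlyNeighbour y x = ∀ u → Adj G y u → u ≡ x

  dominating-pendant : ∀ {D x y} → IsDominating G D → OnlyNeighbour y x →
                       1 ≤ indicator D x + indicator D y
  dominating-pendant {D} {x} {y} dominating only-x with dominating y
  ... | inj₁ y∈D = subst (λ m → 1 ≤ indicator D x + m) (sym (indicator-∈ y∈D)) (m≤n+m 1 _)
  ... | inj₂ (u , y~u , u∈D) with only-x u y~u
  ... | refl = subst (λ m → 1 ≤ m + indicator D y) (sym (indicator-∈ u∈D)) (s≤s z≤n)

  krtdf-pendant : ∀ {k f x y} → 2 ≤ k → IsKRTDF k G f → OnlyNeighbour y x →
                  2 ≤ ∣ f x ∣ + ∣ f y ∣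
  krtdf-pendant {k} {f} {x} {y} 2≤k (rainbow , total) only-x with shape (f y)
  ... | many 2≤∣fy∣ = ≤-trans 2≤∣fy∣ (m≤n+m _ _)
  ... | empty fy≡⊥ = ≤-trans 2≤k (≤-trans k≤∣fx∣ (m≤m+n _ _))
    where
    -- y must see every colour, and it sees only x.
    all⊆fx : S.⊤ ⊆ f x
    all⊆fx {c} _ with rainbow y fy≡⊥ c
    ... | u , y~u , c∈fu = subst (λ v → c ∈ f v) (only-x u y~u) c∈fu

    k≤∣fx∣ : k ≤ ∣ f x ∣
    k≤∣fx∣ = subst (_≤ ∣ f x ∣) (∣⊤∣≡n k) (p⊆q⇒∣p∣≤∣q∣ all⊆fx)
  ... | single c fy≡⁅c⁆ with total y c fy≡⁅c⁆
  ... | u , y~u , c∈fu with only-x u y~u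
  ... | refl = +-mono-≤ (∈⇒1≤∣∣ c∈fu) (∈⇒1≤∣∣ (subst (c ∈_) (sym fy≡⁅c⁆) (x∈⁅x⁆ c)))

module Structure (a b : ℕ) where
  open Pendant (K⁺ a b)

  V : Set
  V = Fin (a + a + b)

  xv yv : Fin a → V
  xv i = (i ↑ˡ a) ↑ˡ b
  yv i = (a ↑ʳ i) ↑ˡ b

  zv : Fin b → V
  zv j = (a + a) ↑ʳ j

  kind-x : ∀ i → kind a b (xv i) ≡ X i
  kind-x i rewrite splitAt-↑ˡ (a + a) (i ↑ˡ a) b | splitAt-↑ˡ a i a = refl

  kind-y : ∀ i → kind a b (yv i) ≡ Y i
  kind-y i rewrite splitAt-↑ˡ (a + a) (a ↑ʳ i) b | splitAt-↑ʳ a a i = refl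

  kind-z : ∀ j → kind a b (zv j) ≡ Z j
  kind-z j rewrite splitAt-↑ʳ (a + a) b j = refl

  data View : V → Set where
    isX : ∀ i → View (xv i)
    isY : ∀ i → View (yv i)
    isZ : ∀ j → View (zv j)

  view : ∀ v → View v
  view v = subst View (join-splitAt (a + a) b v) (outer (splitAt (a + a) v))
    where
    inner : ∀ s → View (join a a s ↑ˡ b)
    inner (inj₁ i) = isX i
    inner (inj₂ i) = isY i

    outer : ∀ s → View (join (a + a) b s)
    outer (inj₁ w) = subst (λ w → View (w ↑ˡ b)) (join-splitAt a a w) (inner (splitAt a w))
    outer (inj₂ j) = isZ j

  x~y : ∀ i → Adj (K⁺ a b) (xv i) (yv i)
  x~y i = subst₂ KAdj (sym (kind-x i)) (sym (kind-y i)) refl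

  y~x : ∀ i → Adj (K⁺ a b) (yv i) (xv i)
  y~x i = subst₂ KAdj (sym (kind-y i)) (sym (kind-x i)) refl

  z~x : ∀ j i → Adj (K⁺ a b) (zv j) (xv i)
  z~x j i = subst₂ KAdj (sym (kind-z j)) (sym (kind-x i)) tt

  y-pendant : ∀ i → OnlyNeighbour (yv i) (xv i)
  y-pendant i u y~u rewrite kind-y i with view u
  ... | isX i' rewrite kind-x i' = cong xv (sym y~u)
  ... | isY i' rewrite kind-y i' = ⊥-elim y~u
  ... | isZ j  rewrite kind-z j  = ⊥-elim y~u

  ∑-pairs : (g : V → ℕ) → ∑ g ≡ ∑ (λ i → g (xv i) + g (yv i)) + ∑ (λ j → g (zv j))
  ∑-pairs g = begin
    ∑ g
      ≡⟨ ∑-split (a + a) g ⟩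
    ∑ (λ w → g (w ↑ˡ b)) + ∑ (λ j → g (zv j))
      ≡⟨ cong (_+ ∑ (λ j → g (zv j))) (∑-split a (λ w → g (w ↑ˡ b))) ⟩
    ∑ (λ i → g (xv i)) + ∑ (λ i → g (yv i)) + ∑ (λ j → g (zv j))
      ≡⟨ cong (_+ ∑ (λ j → g (zv j))) (∑-+ (λ i → g (xv i)) (λ i → g (yv i))) ⟨
    ∑ (λ i → g (xv i) + g (yv i)) + ∑ (λ j → g (zv j))  ∎

  ∑-pairs-lower : ∀ c (g : V → ℕ) → (∀ i → c ≤ g (xv i) + g (yv i)) → a * c ≤ ∑ g
  ∑-pairs-lower c g c≤pair =
    subst (a * c ≤_) (sym (∑-pairs g)) (≤-trans (∑-lower c _ c≤pair) (m≤m+n _ _))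

  ∑-pairs-exact : ∀ c (g : V → ℕ) → (∀ i → g (xv i) + g (yv i) ≡ c) → (∀ j → g (zv j) ≡ 0) →
                  ∑ g ≡ a * c
  ∑-pairs-exact c g pair≡c z≡0 = begin
    ∑ g                                                  ≡⟨ ∑-pairs g ⟩
    ∑ (λ i → g (xv i) + g (yv i)) + ∑ (λ j → g (zv j))  ≡⟨ cong₂ _+_ (∑-cong pair≡c) (∑-cong z≡0) ⟩
    ∑ {a} (λ _ → c) + ∑ {b} (λ _ → 0)                   ≡⟨ cong₂ _+_ (∑-const a c) (∑-const b 0) ⟩
    a * c + b * 0                                        ≡⟨ cong (a * c +_) (*-zeroʳ b) ⟩
    a * c + 0                                            ≡⟨ +-identityʳ (a * c) ⟩
    a * c                                                ∎

  domination-lower : ∀ D → IsDominating (K⁺ a b) D → a ≤ ∣ D ∣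
  domination-lower D dominating =
    subst₂ _≤_ (*-identityʳ a) (sym (∣∣≡∑indicator D))
      (∑-pairs-lower 1 (indicator D) (λ i → dominating-pendant dominating (y-pendant i)))

  inA : Kind a b → Side
  inA (X _) = inside
  inA (Y _) = outside
  inA (Z _) = outside

  A : Subset (a + a + b)
  A = tabulate (λ v → inA (kind a b v))

  lookup-A : ∀ v t → kind a b v ≡ t → lookup A v ≡ inA t
  lookup-A v t kind≡t = trans (lookup∘tabulate _ v) (cong inA kind≡t)

  x∈A : ∀ i → xv i ∈ A
  x∈A i = lookup⇒[]= (xv i) A (lookup-A (xv i) (X i) (kind-x i))

  A-dominating : Fin a → IsDominating (K⁺ a b) A
  A-dominating x₀ v with view v
  ... | isX i = inj₁ (x∈A i)
  ... | isY i = inj₂ (xv i , y~x i , x∈A i)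
  ... | isZ j = inj₂ (xv x₀ , z~x j x₀ , x∈A x₀)

  ∣A∣≡a : ∣ A ∣ ≡ a
  ∣A∣≡a = begin
    ∣ A ∣             ≡⟨ ∣∣≡∑indicator A ⟩
    ∑ (indicator A)   ≡⟨ ∑-pairs-exact 1 (indicator A) pair z ⟩
    a * 1             ≡⟨ *-identityʳ a ⟩
    a                 ∎
    where
    pair : ∀ i → indicator A (xv i) + indicator A (yv i) ≡ 1
    pair i = cong₂ _+_ (cong count (lookup-A (xv i) (X i) (kind-x i)))
                       (cong count (lookup-A (yv i) (Y i) (kind-y i)))

    z : ∀ j → indicator A (zv j) ≡ 0
    z j = cong count (lookup-A (zv j) (Z j) (kind-z j))

  krtdf-lower : ∀ {k} → 2 ≤ k → ∀ f → IsKRTDF k (K⁺ a b) f → 2 * a ≤ weight k (K⁺ a b) f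
  krtdf-lower 2≤k f krtdf =
    subst (_≤ weight _ (K⁺ a b) f) (*-comm a 2)
      (∑-pairs-lower 2 (λ v → ∣ f v ∣) (λ i → krtdf-pendant 2≤k krtdf (y-pendant i)))

  module Colouring (k : ℕ) .{{_ : NonZero k}} (k≤a : k ≤ a) where

    colour : Fin a → Fin k
    colour i = fromℕ< (m%n<n (toℕ i) k)

    -- Since k ≤ a, every colour c is the colour of x_c.
    colour-inject : ∀ c → colour (inject≤ c k≤a) ≡ c
    colour-inject c = toℕ-injective (begin
      toℕ (colour (inject≤ c k≤a))  ≡⟨ toℕ-fromℕ< _ ⟩
      toℕ (inject≤ c k≤a) % k       ≡⟨ cong (_% k) (toℕ-inject≤ c k≤a) ⟩
      toℕ c % k                     ≡⟨ m<n⇒m%n≡m (toℕ<n c) ⟩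
      toℕ c                         ∎)

    label : Kind a b → Subset k
    label (X i) = ⁅ colour i ⁆
    label (Y i) = ⁅ colour i ⁆
    label (Z _) = S.⊥

    f : V → Subset k
    f v = label (kind a b v)

    f-x : ∀ i → f (xv i) ≡ ⁅ colour i ⁆
    f-x i = cong label (kind-x i)

    f-y : ∀ i → f (yv i) ≡ ⁅ colour i ⁆
    f-y i = cong label (kind-y i)

    f-z : ∀ j → f (zv j) ≡ S.⊥
    f-z j = cong label (kind-z j)

    -- Only the vertices of B are unlabelled, and each sees x_c carrying colour c.
    f-rainbow : IsKRDF k (K⁺ a b) f
    f-rainbow v fv≡⊥ c with view v
    ... | isX i = ⊥-elim (single≢⊥ (colour i) (trans (sym (f-x i)) fv≡⊥))
    ... | isY i = ⊥-elim (single≢⊥ (colour i) (trans (sym (f-y i)) fv≡⊥))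
    ... | isZ j = xv (inject≤ c k≤a) , z~x j _ , c∈f-x
      where
      c∈f-x : c ∈ f (xv (inject≤ c k≤a))
      c∈f-x = subst (c ∈_) (sym (trans (f-x _) (cong ⁅_⁆ (colour-inject c)))) (x∈⁅x⁆ c)

    -- The partners x_i and y_i carry the same singleton.
    f-total : ∀ v c → f v ≡ ⁅ c ⁆ → ∃ λ u → Adj (K⁺ a b) v u × c ∈ f u
    f-total v c fv≡⁅c⁆ with view v
    ... | isX i = yv i , x~y i , subst (c ∈_) (sym (trans (f-y i) (trans (sym (f-x i)) fv≡⁅c⁆))) (x∈⁅x⁆ c)
    ... | isY i = xv i , y~x i , subst (c ∈_) (sym (trans (f-x i) (trans (sym (f-y i)) fv≡⁅c⁆))) (x∈⁅x⁆ c)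
    ... | isZ j = ⊥-elim (single≢⊥ c (trans (sym fv≡⁅c⁆) (f-z j)))

    weight-f : weight k (K⁺ a b) f ≡ 2 * a
    weight-f = trans (∑-pairs-exact 2 (λ v → ∣ f v ∣) pair z) (*-comm a 2)
      where
      pair : ∀ i → ∣ f (xv i) ∣ + ∣ f (yv i) ∣ ≡ 2
      pair i = cong₂ _+_ (trans (cong ∣_∣ (f-x i)) (∣⁅x⁆∣≡1 (colour i)))
                         (trans (cong ∣_∣ (f-y i)) (∣⁅x⁆∣≡1 (colour i)))

      z : ∀ j → ∣ f (zv j) ∣ ≡ 0
      z j = trans (cong ∣_∣ (f-z j)) (∣⊥∣≡0 k)

-- Both parameters attain their lower bounds, via A and the colouring f.
lemma1 : (a b k : ℕ) → 1 ≤ a → 1 ≤ b → 2 ≤ k → k ≤ a →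
    DominationNumberIs (K⁺ a b) a × KRTDNumberIs k (K⁺ a b) (2 * a)
lemma1 a b k 1≤a _ 2≤k k≤a =
  ((A , A-dominating (fromℕ< 1≤a) , ∣A∣≡a) , domination-lower) ,
  ((f , (f-rainbow , f-total) , weight-f) , krtdf-lower 2≤k)
  where
  open Structure a b
  instance
    k-nonZero : NonZero k
    k-nonZero = >-nonZero (≤-trans (s≤s z≤n) 2≤k)
  open Colouring k k≤a
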